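{- Let $m\ge 1$, $a\in\{0,1\}^{m+1}$, $n\ge1$, and fix $i\in\{1,\dots,n\}$. Let $\Upsilon=(\varphi_{j_r},\dots,\varphi_{j_1})$ be a list of simple maps on $\{0,1\}^n$ (for keyword $a$) satisfying all of: (i) $j_1,\dots,j_r>i$; (ii) $\varphi_i\circ\Upsilon\neq\Upsilon\circ\varphi_i$ as maps on $\{0,1\}^n$; (iii) there is some $x\in\{0,1\}^n$ such that the list $(\varphi_i,\varphi_{j_r},\dots,\varphi_{j_1},\varphi_i)$ acts completely on $x$. Then, with $j=\min\{j_1,\dots,j_r\}$, the list $\Upsilon$ contains an even number of instances of $\varphi_j$ (i.e. the number of $q$ with $j_q=j$ is even).
   Context: Binary words are elements of $\{0,1\}^n$; $\neg$ flips every letter; $u_{[i,j]}=(u_i,\dots,u_j)$. For a keyword $a\in\{0,1\}^{m+1}$ and $i\in\{1,\dots,n\}$, the simple map $\varphi_i=\varphi_i^{(a)}:\{0,1\}^n\to\{0,1\}^n$ negates the letters of $u$ in positions $i,\dots,i+m$ if $i+m\le n$ and $u_{[i,i+m]}\in\{a,\neg a\}$, and otherwise returns $u$ unchanged. A list of simple maps $\Phi=(\varphi_{i_r},\dots,\varphi_{i_1})$ acts on words as the composition $\Phi(u)=(\varphi_{i_r}\circ\cdots\circ\varphi_{i_1})(u)$ (the rightmost map is applied first). Such a list acts completely on $u$ if $(\varphi_{i_q}\circ\cdots\circ\varphi_{i_1})(u)\neq(\varphi_{i_{q-1}}\circ\cdots\circ\varphi_{i_1})(u)$ for every $q\in\{1,\dots,r\}$,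 i.e. each map performs an actual substitution. -}

module Defs where

open import Data.Bool using (Bool; not; true; false; if_then_else_)
open import Data.Bool.Properties using () renaming (_≟_ to _≟B_)
open import Data.Nat using (ℕ; zero; suc; _+_; _∸_; _≤_; _<_; _≤?_)
open import Data.List using (List; []; _∷_; reverse; length; filter; foldr)
open import Data.List.Properties using (≡-dec)
open import Data.Vec using (Vec; toList)
open import Data.Product using (_×_)
open import Data.Unit using (⊤)
open import Relation.Nullary using (¬_; Dec; yes; no; _⊎-dec_; _×-dec_)
open import Relation.Binary.PropositionalEquality using (_≡_; _≢_)
open import Function using (id; _∘_)

Word : ℕ → Set
Word n = Vec Bool n

negL : List Bool → List Bool
negL = Data.List.map not

-- Positions are 1-based.  flipFrom k len u negates the letters of u at
-- positions k+1, …, k+len (0-based offset k).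
flipFrom : ∀ {n} → ℕ → ℕ → Vec Bool n → Vec Bool n
flipFrom _       zero    u            = u
flipFrom _       (suc _) Vec.[]       = Vec.[]
flipFrom zero    (suc l) (x Vec.∷ u)  = not x Vec.∷ flipFrom zero l u
flipFrom (suc k) (suc l) (x Vec.∷ u)  = x Vec.∷ flipFrom k (suc l) u

factor : ∀ {n} → ℕ → ℕ → Vec Bool n → List Bool
factor k len u = Data.List.take len (Data.List.drop k (toList u))

φ : ∀ {m n} → Vec Bool (suc m) → ℕ → Word n → Word n
φ {m} {n} a i u with (1 ≤? i) ×-dec (i + m ≤? n)
                     ×-dec (≡-dec _≟B_ (factor (i ∸ 1) (suc m) u) (toList a)
                            ⊎-dec ≡-dec _≟B_ (factor (i ∸ 1) (suc m) u) (negL (toList a)))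
... | yes _ = flipFrom (i ∸ 1) (suc m) u
... | no  _ = u

-- A list of simple maps (φ_{i_r}, …, φ_{i_1}) is represented by the list of
-- indices i_r ∷ … ∷ i_1 ∷ [] (written order; the head is applied LAST).
applyList : ∀ {m n} → Vec Bool (suc m) → List ℕ → Word n → Word n
applyList a = foldr (λ k f → φ a k ∘ f) id

-- completeness along a list given in APPLICATION order (first applied first)
completeApp : ∀ {m n} → Vec Bool (suc m) → List ℕ → Word n → Set
completeApp a []       u = ⊤
completeApp a (k ∷ ks) u = (φ a k u ≢ u) × completeApp a ks (φ a k u)

ActsCompletely : ∀ {m n} → Vec Bool (suc m) → List ℕ → Word n → Set
ActsCompletely a Φ u = completeApp a (reverse Φ) u

minList : ℕ → List ℕ → ℕ
minList k []       = k
minList k (l ∷ ls) = k Data.Nat.⊓ minList l ls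

count : ℕ → List ℕ → ℕ
count j ks = length (filter (Data.Nat._≟ j) ks)

{-# OPTIONS --safe #-}
module Submission where

-- Put y = φᵢ x and z = Υ y.  Both substitutions by φᵢ are actual, so the
-- windows of y and z at i are a or ¬a.  Every map of Υ acts strictly right of
-- position i, so y and z agree at i; as a and ¬a differ in their first letter,
-- y and z agree on the whole window at i.  If j > i + m, every window of Υ
-- would be disjoint from the window at i and φᵢ would commute with Υ; hence
-- position j lies in the window at i, and y and z agree at j.  Since Υ acts
-- completely on y, the letter at j is negated exactly by the instances of φⱼ
-- (all other maps act strictly right of j), so there is an even number of them.

open import Defs
open import Data.Bool using (Bool; false; not)
open import Data.Bool.Properties using (not-involutive; not-¬) renaming (_≟_ to _≟B_)
open import Data.Empty using (⊥-elim)
open import Data.List using (List; []; _∷_; _++_; take; drop; reverse; length)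
open import Data.List.Membership.Propositional using (_∈_)
open import Data.List.Properties
  using (≡-dec; map-∘; map-cong; map-id; unfold-reverse; reverse-++; reverse-involutive; filter-accept; filter-reject)
open import Data.List.Relation.Unary.All as All using (All; []; _∷_)
open import Data.List.Relation.Unary.Any using (here; there)
open import Data.Nat
open import Data.Nat.Divisibility using (_∣_; divides; ∣-refl; ∣m∣n⇒∣m+n)
open import Data.Nat.GeneralisedArithmetic using (fold)
open import Data.Nat.Properties
open import Data.Product using (_×_; _,_; ∃)
open import Data.Sum as Sum using (_⊎_; inj₁; inj₂; swap)
open import Data.Vec using (Vec; toList)
open import Function using (_∘_)
open import Relation.Binary.PropositionalEquality
open import Relation.Nullary using (¬_; yes; no; _×-dec_; _⊎-dec_)

open ≡-Reasoning

minList-∈ : ∀ k ks → minList k ks ∈ k ∷ ks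
minList-∈ k []       = here refl
minList-∈ k (l ∷ ls) with ⊓-sel k (minList l ls)
... | inj₁ min≡k = here min≡k
... | inj₂ min≡M = there (subst (_∈ l ∷ ls) (sym min≡M) (minList-∈ l ls))

minList-≤ : ∀ k ks → All (minList k ks ≤_) (k ∷ ks)
minList-≤ k []       = ≤-refl ∷ []
minList-≤ k (l ∷ ls) = m⊓n≤m k _ ∷ All.map (≤-trans (m⊓n≤n k _)) (minList-≤ l ls)

count-∷-≡ : ∀ j ks → count j (j ∷ ks) ≡ suc (count j ks)
count-∷-≡ j ks = cong length (filter-accept (_≟ j) {j} {ks} refl)

count-∷-≢ : ∀ {j k} ks → k ≢ j → count j (k ∷ ks) ≡ count j ks
count-∷-≢ {j} {k} ks k≢j = cong length (filter-reject (_≟ j) {k} {ks} k≢j)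

fold-not-fixed⇒even : ∀ c {b} → fold b not c ≡ b → 2 ∣ c
fold-not-fixed⇒even zero          _ = divides 0 refl
fold-not-fixed⇒even (suc zero)    e = ⊥-elim (not-¬ refl (sym e))
fold-not-fixed⇒even (suc (suc c)) e =
  ∣m∣n⇒∣m+n ∣-refl (fold-not-fixed⇒even c (trans (sym (not-involutive _)) e))

negL-involutive : ∀ xs → negL (negL xs) ≡ xs
negL-involutive xs = trans (sym (map-∘ xs)) (trans (map-cong not-involutive xs) (map-id xs))

-- Positions are 0-based; past the end of the list the junk letter false is returned.
letterAt : ℕ → List Bool → Bool
letterAt _       []       = false
letterAt zero    (x ∷ _)  = x
letterAt (suc p) (_ ∷ xs) = letterAt p xs

letter : ∀ {n} → ℕ → Word n → Bool
letter p u = letterAt p (toList u)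

letterAt-take : ∀ {d l} xs → d < l → letterAt d (take l xs) ≡ letterAt d xs
letterAt-take {l = suc _}    []       _         = refl
letterAt-take {zero}  {suc _} (_ ∷ _)  _         = refl
letterAt-take {suc d} {suc l} (_ ∷ xs) (s≤s d<l) = letterAt-take xs d<l

letterAt-drop : ∀ s {d} xs → letterAt d (drop s xs) ≡ letterAt (s + d) xs
letterAt-drop zero    xs       = refl
letterAt-drop (suc s) []       = refl
letterAt-drop (suc s) (_ ∷ xs) = letterAt-drop s xs

letterAt-factor : ∀ {n} s {d l} (u : Word n) → d < l → letterAt d (factor s l u) ≡ letter (s + d) u
letterAt-factor s u d<l = trans (letterAt-take (drop s (toList u)) d<l) (letterAt-drop s (toList u))

factor-≡⇒letter-≡ : ∀ {n s l p} (u v : Word n) → factor s l u ≡ factor s l v →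
                    s ≤ p → p < s + l → letter p u ≡ letter p v
factor-≡⇒letter-≡ {s = s} {l} {p} u v same s≤p p<s+l =
  subst (λ q → letter q u ≡ letter q v) (m+[n∸m]≡n s≤p) (begin
    letter (s + (p ∸ s)) u  ≡⟨ letterAt-factor s u d<l ⟨
    letterAt (p ∸ s) (factor s l u) ≡⟨ cong (letterAt (p ∸ s)) same ⟩
    letterAt (p ∸ s) (factor s l v) ≡⟨ letterAt-factor s v d<l ⟩
    letter (s + (p ∸ s)) v  ∎)
  where
  d<l : p ∸ s < l
  d<l = subst (p ∸ s <_) (m+n∸m≡n s l) (∸-monoˡ-< p<s+l s≤p)

flipFrom-comm : ∀ {n} s l t l' (u : Word n) → flipFrom s l (flipFrom t l' u) ≡ flipFrom t l' (flipFrom s l u)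
flipFrom-comm s       zero    t       l'       u           = refl
flipFrom-comm s       (suc l) t       zero     u           = refl
flipFrom-comm s       (suc l) t       (suc l') Vec.[]      = refl
flipFrom-comm zero    (suc l) zero    (suc l') (x Vec.∷ u) = cong (not (not x) Vec.∷_) (flipFrom-comm zero l zero l' u)
flipFrom-comm zero    (suc l) (suc t) (suc l') (x Vec.∷ u) = cong (not x Vec.∷_) (flipFrom-comm zero l t (suc l') u)
flipFrom-comm (suc s) (suc l) zero    (suc l') (x Vec.∷ u) = cong (not x Vec.∷_) (flipFrom-comm s (suc l) zero l' u)
flipFrom-comm (suc s) (suc l) (suc t) (suc l') (x Vec.∷ u) = cong (x Vec.∷_) (flipFrom-comm s (suc l) t (suc l') u)

factor-flipFrom-apart : ∀ {n s l t l'} (u : Word n) → s + l ≤ t ⊎ t + l' ≤ s →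
                        factor s l (flipFrom t l' u) ≡ factor s l u
factor-flipFrom-apart {l' = zero}  u          _ = refl
factor-flipFrom-apart {l' = suc _} Vec.[]     _ = refl
factor-flipFrom-apart {s = zero} {zero} (_ Vec.∷ _) _ = refl
factor-flipFrom-apart {s = zero} {suc l} {suc t} {suc _} (x Vec.∷ u) (inj₁ (s≤s l≤t)) =
  cong (x ∷_) (factor-flipFrom-apart {s = zero} u (inj₁ l≤t))
factor-flipFrom-apart {s = zero} {suc _} {zero}  {suc _} (_ Vec.∷ _) (inj₁ ())
factor-flipFrom-apart {s = zero} {suc _} {zero}  {suc _} (_ Vec.∷ _) (inj₂ ())
factor-flipFrom-apart {s = zero} {suc _} {suc _} {suc _} (_ Vec.∷ _) (inj₂ ())
factor-flipFrom-apart {s = suc s} {t = zero} {suc l'} (_ Vec.∷ u) (inj₂ (s≤s l'≤s)) =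
  factor-flipFrom-apart {s = s} {t = zero} {l'} u (inj₂ l'≤s)
factor-flipFrom-apart {s = suc s} {t = suc t} {suc _} (_ Vec.∷ u) apart =
  factor-flipFrom-apart {s = s} {t = t} u (Sum.map s≤s⁻¹ s≤s⁻¹ apart)

factor-flipFrom-self : ∀ {n} t l (u : Word n) → factor t l (flipFrom t l u) ≡ negL (factor t l u)
factor-flipFrom-self t       zero    u           = refl
factor-flipFrom-self zero    (suc l) Vec.[]      = refl
factor-flipFrom-self (suc t) (suc l) Vec.[]      = refl
factor-flipFrom-self zero    (suc l) (x Vec.∷ u) = cong (not x ∷_) (factor-flipFrom-self zero l u)
factor-flipFrom-self (suc t) (suc l) (_ Vec.∷ u) = factor-flipFrom-self t (suc l) u

letter-flipFrom-< : ∀ {n p t l} (u : Word n) → p < t → letter p (flipFrom t l u) ≡ letter p u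
letter-flipFrom-< {l = zero}  u          _ = refl
letter-flipFrom-< {l = suc _} Vec.[]     _ = refl
letter-flipFrom-< {p = zero}  {suc t} {suc l} (_ Vec.∷ u) _ = refl
letter-flipFrom-< {p = suc p} {suc t} {suc l} (_ Vec.∷ u) (s≤s p<t) = letter-flipFrom-< {l = suc l} u p<t

letter-flipFrom-start : ∀ {n} t l (u : Word n) → t < n → letter t (flipFrom t (suc l) u) ≡ not (letter t u)
letter-flipFrom-start zero    l (_ Vec.∷ u) _         = refl
letter-flipFrom-start (suc t) l (_ Vec.∷ u) (s≤s t<n) = letter-flipFrom-start t l u t<n

Matches : ∀ {m} → Vec Bool (suc m) → List Bool → Set
Matches a w = w ≡ toList a ⊎ w ≡ negL (toList a)

Matches-negL : ∀ {m} (a : Vec Bool (suc m)) {w} → Matches a w → Matches a (negL w)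
Matches-negL a (inj₁ w≡a)  = inj₂ (cong negL w≡a)
Matches-negL a (inj₂ w≡¬a) = inj₁ (trans (cong negL w≡¬a) (negL-involutive (toList a)))

Matches-≡ : ∀ {m} (a : Vec Bool (suc m)) {w w'} → Matches a w → Matches a w' →
            letterAt 0 w ≡ letterAt 0 w' → w ≡ w'
Matches-≡ a             (inj₁ refl) (inj₁ refl) _ = refl
Matches-≡ a             (inj₂ refl) (inj₂ refl) _ = refl
Matches-≡ (_ Vec.∷ _) (inj₁ refl) (inj₂ refl) e = ⊥-elim (not-¬ refl e)
Matches-≡ (_ Vec.∷ _) (inj₂ refl) (inj₁ refl) e = ⊥-elim (not-¬ refl (sym e))

applyList-++ : ∀ {m n} (a : Vec Bool (suc m)) xs ys (u : Word n) →
               applyList a (xs ++ ys) u ≡ applyList a xs (applyList a ys u)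
applyList-++ a []       ys u = refl
applyList-++ a (k ∷ xs) ys u = cong (φ a k) (applyList-++ a xs ys u)

Apart : ℕ → ℕ → ℕ → Set
Apart m i k = (i ∸ 1) + suc m ≤ k ∸ 1 ⊎ (k ∸ 1) + suc m ≤ i ∸ 1

<⇒Apart : ∀ {m i k} → 1 ≤ i → i + m < k → Apart m i k
<⇒Apart {m} {suc i} {k} _ i+m<k = inj₁ (subst (_≤ k ∸ 1) (sym (+-suc i m)) (∸-monoˡ-≤ 1 i+m<k))

module _ {m n : ℕ} (a : Vec Bool (suc m)) where

  window : ℕ → Word n → List Bool
  window k = factor (k ∸ 1) (suc m)

  flipWindow : ℕ → Word n → Word n
  flipWindow k = flipFrom (k ∸ 1) (suc m)

  Applies : ℕ → List Bool → Set
  Applies k w = 1 ≤ k × k + m ≤ n × Matches a w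

  φ-view : ∀ k (u : Word n) → ¬ Applies k (window k u) × φ a k u ≡ u
                              ⊎ Applies k (window k u) × φ a k u ≡ flipWindow k u
  φ-view k u with (1 ≤? k) ×-dec (k + m ≤? n)
                   ×-dec (≡-dec _≟B_ (window k u) (toList a) ⊎-dec ≡-dec _≟B_ (window k u) (negL (toList a)))
  ... | yes applies = inj₂ (applies , refl)
  ... | no ¬applies = inj₁ (¬applies , refl)

  φ-unchanged : ∀ {k} {u : Word n} → ¬ Applies k (window k u) → φ a k u ≡ u
  φ-unchanged {k} {u} ¬applies with φ-view k u
  ... | inj₁ (_ , φu≡u)      = φu≡u
  ... | inj₂ (applies , _)   = ⊥-elim (¬applies applies)

  φ-applies : ∀ {k} {u : Word n} → Applies k (window k u) → φ a k u ≡ flipWindow k u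
  φ-applies {k} {u} applies with φ-view k u
  ... | inj₁ (¬applies , _)  = ⊥-elim (¬applies applies)
  ... | inj₂ (_ , φu≡flip)   = φu≡flip

  φ-changed : ∀ k (u : Word n) → φ a k u ≢ u → Applies k (window k u) × φ a k u ≡ flipWindow k u
  φ-changed k u changed with φ-view k u
  ... | inj₁ (_ , φu≡u) = ⊥-elim (changed φu≡u)
  ... | inj₂ applies    = applies

  φ-id-or-flipWindow : ∀ k (u : Word n) → φ a k u ≡ u ⊎ φ a k u ≡ flipWindow k u
  φ-id-or-flipWindow k u with φ-view k u
  ... | inj₁ (_ , φu≡u)    = inj₁ φu≡u
  ... | inj₂ (_ , φu≡flip) = inj₂ φu≡flip

  φ-natural : ∀ k (f : Word n → Word n) → (∀ v → window k (f v) ≡ window k v) →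
              (∀ v → f (flipWindow k v) ≡ flipWindow k (f v)) → ∀ u → φ a k (f u) ≡ f (φ a k u)
  φ-natural k f keeps commutes u with φ-view k u
  ... | inj₁ (¬applies , φu≡u) = begin
    φ a k (f u)  ≡⟨ φ-unchanged (¬applies ∘ subst (Applies k) (keeps u)) ⟩
    f u          ≡⟨ cong f φu≡u ⟨
    f (φ a k u)  ∎
  ... | inj₂ (applies , φu≡flip) = begin
    φ a k (f u)           ≡⟨ φ-applies (subst (Applies k) (sym (keeps u)) applies) ⟩
    flipWindow k (f u)    ≡⟨ commutes u ⟨
    f (flipWindow k u)    ≡⟨ cong f φu≡flip ⟨
    f (φ a k u)           ∎

  window-φ-apart : ∀ i k → Apart m i k → ∀ v → window k (φ a i v) ≡ window k v
  window-φ-apart i k apart v with φ-id-or-flipWindow i v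
  ... | inj₁ φv≡v    = cong (window k) φv≡v
  ... | inj₂ φv≡flip = trans (cong (window k) φv≡flip) (factor-flipFrom-apart v (swap apart))

  φ-flipWindow-apart : ∀ i k → Apart m i k → ∀ v → φ a i (flipWindow k v) ≡ flipWindow k (φ a i v)
  φ-flipWindow-apart i k apart =
    φ-natural i (flipWindow k) (λ v → factor-flipFrom-apart v apart)
      (λ v → flipFrom-comm (k ∸ 1) (suc m) (i ∸ 1) (suc m) v)

  φ-comm-apart : ∀ i k → Apart m i k → ∀ u → φ a i (φ a k u) ≡ φ a k (φ a i u)
  φ-comm-apart i k apart u =
    sym (φ-natural k (φ a i) (window-φ-apart i k apart) (φ-flipWindow-apart i k apart) u)

  φ-comm-applyList : ∀ i ks (u : Word n) → All (Apart m i) ks →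
                     φ a i (applyList a ks u) ≡ applyList a ks (φ a i u)
  φ-comm-applyList i []       u []               = refl
  φ-comm-applyList i (k ∷ ks) u (apart ∷ aparts) =
    trans (φ-comm-apart i k apart _) (cong (φ a k) (φ-comm-applyList i ks u aparts))

  letter-φ-< : ∀ {p} k (u : Word n) → p < k ∸ 1 → letter p (φ a k u) ≡ letter p u
  letter-φ-< {p} k u p<k with φ-id-or-flipWindow k u
  ... | inj₁ φu≡u    = cong (letter p) φu≡u
  ... | inj₂ φu≡flip = trans (cong (letter p) φu≡flip) (letter-flipFrom-< {l = suc m} u p<k)

  letter-applyList-< : ∀ {p} ks (u : Word n) → All (λ k → p < k ∸ 1) ks →
                       letter p (applyList a ks u) ≡ letter p u
  letter-applyList-< []       u []           = refl
  letter-applyList-< (k ∷ ks) u (p<k ∷ p<ks) =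
    trans (letter-φ-< k _ p<k) (letter-applyList-< ks u p<ks)

  letter-φ-changed : ∀ k (u : Word n) → φ a k u ≢ u → letter (k ∸ 1) (φ a k u) ≡ not (letter (k ∸ 1) u)
  letter-φ-changed (suc k) u changed with φ-changed (suc k) u changed
  ... | (_ , 1+k+m≤n , _) , φu≡flip =
    trans (cong (letter k) φu≡flip) (letter-flipFrom-start k m u (≤-trans (m≤m+n (suc k) m) 1+k+m≤n))
  letter-φ-changed zero u changed with φ-changed zero u changed
  ... | (() , _) , _

  Matches-window-changed : ∀ k (u : Word n) → φ a k u ≢ u → Matches a (window k u)
  Matches-window-changed k u changed with φ-changed k u changed
  ... | (_ , _ , matches) , _ = matches

  Matches-window-φ-changed : ∀ k (u : Word n) → φ a k u ≢ u → Matches a (window k (φ a k u))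
  Matches-window-φ-changed k u changed with φ-changed k u changed
  ... | (_ , _ , matches) , φu≡flip =
    subst (Matches a) (sym (trans (cong (window k) φu≡flip) (factor-flipFrom-self (k ∸ 1) (suc m) u)))
      (Matches-negL a matches)

  window-≡ : ∀ k {u v : Word n} → Matches a (window k u) → Matches a (window k v) →
             letter (k ∸ 1) u ≡ letter (k ∸ 1) v → window k u ≡ window k v
  window-≡ k {u} {v} matches-u matches-v same-first = Matches-≡ a matches-u matches-v (begin
    letterAt 0 (window k u)  ≡⟨ first-letter u ⟩
    letter (k ∸ 1) u         ≡⟨ same-first ⟩
    letter (k ∸ 1) v         ≡⟨ first-letter v ⟨
    letterAt 0 (window k v)  ∎)
    where
    first-letter : ∀ w → letterAt 0 (window k w) ≡ letter (k ∸ 1) w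
    first-letter w = trans (letterAt-factor (k ∸ 1) w z<s) (cong (λ p → letter p w) (+-identityʳ (k ∸ 1)))

  window-≡⇒letter-≡ : ∀ {k j} (u v : Word n) → window k u ≡ window k v →
                      1 ≤ k → k ≤ j → j ≤ k + m → letter (j ∸ 1) u ≡ letter (j ∸ 1) v
  window-≡⇒letter-≡ {suc k} u v same _ k≤j j≤k+m =
    factor-≡⇒letter-≡ u v same (∸-monoˡ-≤ 1 k≤j)
      (≤-<-trans (∸-monoˡ-≤ 1 j≤k+m) (+-monoʳ-< k (n<1+n m)))

  ¬comm⇒lowerBound≤ : ∀ i ks → 1 ≤ i →
                      ¬ (∀ u → φ a i (applyList a ks u) ≡ applyList a ks (φ a i u)) →
                      ∀ {j} → All (j ≤_) ks → j ≤ i + m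
  ¬comm⇒lowerBound≤ i ks 1≤i noncommuting {j} j≤ks with j ≤? i + m
  ... | yes j≤i+m = j≤i+m
  ... | no j≰i+m  = ⊥-elim (noncommuting λ u → φ-comm-applyList i ks u
                      (All.map (λ j≤k → <⇒Apart 1≤i (<-≤-trans (≰⇒> j≰i+m) j≤k)) j≤ks))

  completeApp-++ : ∀ xs ys (u : Word n) → completeApp a (xs ++ ys) u →
                   completeApp a xs u × completeApp a ys (applyList a (reverse xs) u)
  completeApp-++ []       ys u complete            = _ , complete
  completeApp-++ (k ∷ xs) ys u (changed , complete) with completeApp-++ xs ys (φ a k u) complete
  ... | on-xs , on-ys = (changed , on-xs) , subst (completeApp a ys) (sym reverse-∷) on-ys
    where
    reverse-∷ : applyList a (reverse (k ∷ xs)) u ≡ applyList a (reverse xs) (φ a k u)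
    reverse-∷ = trans (cong (λ zs → applyList a zs u) (unfold-reverse k xs)) (applyList-++ a (reverse xs) (k ∷ []) u)

  ActsCompletely-++ : ∀ Φ Ψ (u : Word n) → ActsCompletely a (Φ ++ Ψ) u →
                      ActsCompletely a Ψ u × ActsCompletely a Φ (applyList a Ψ u)
  ActsCompletely-++ Φ Ψ u complete
    with completeApp-++ (reverse Ψ) (reverse Φ) u (subst (λ zs → completeApp a zs u) (reverse-++ Φ Ψ) complete)
  ... | on-Ψ , on-Φ = on-Ψ , subst (λ zs → ActsCompletely a Φ (applyList a zs u)) (reverse-involutive Ψ) on-Φ

  ActsCompletely-∷ : ∀ k Φ (u : Word n) → ActsCompletely a (k ∷ Φ) u →
                     ActsCompletely a Φ u × φ a k (applyList a Φ u) ≢ applyList a Φ u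
  ActsCompletely-∷ k Φ u complete with ActsCompletely-++ (k ∷ []) Φ u complete
  ... | on-Φ , (changed , _) = on-Φ , changed

  ActsCompletely-sandwich : ∀ k Φ (x : Word n) → ActsCompletely a (k ∷ Φ ++ k ∷ []) x →
                            φ a k x ≢ x × ActsCompletely a Φ (φ a k x)
                            × φ a k (applyList a Φ (φ a k x)) ≢ applyList a Φ (φ a k x)
  ActsCompletely-sandwich k Φ x complete with ActsCompletely-∷ k (Φ ++ k ∷ []) x complete
  ... | inner , last-changed with ActsCompletely-++ Φ (k ∷ []) x inner
  ...   | (first-changed , _) , on-Φ =
    first-changed , on-Φ , subst (λ z → φ a k z ≢ z) (applyList-++ a Φ (k ∷ []) x) last-changed

  letter-applyList-count : ∀ {j} ks (u : Word n) → 1 ≤ j → All (j ≤_) ks → ActsCompletely a ks u →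
                           letter (j ∸ 1) (applyList a ks u) ≡ fold (letter (j ∸ 1) u) not (count j ks)
  letter-applyList-count []       u _ _ _ = refl
  letter-applyList-count {j} (k ∷ ks) u 1≤j (j≤k ∷ j≤ks) complete
    with ActsCompletely-∷ k ks u complete | k ≟ j
  ... | on-ks , changed | yes refl = begin
    letter (k ∸ 1) (φ a k (applyList a ks u))    ≡⟨ letter-φ-changed k _ changed ⟩
    not (letter (k ∸ 1) (applyList a ks u))      ≡⟨ cong not (letter-applyList-count ks u 1≤j j≤ks on-ks) ⟩
    fold (letter (k ∸ 1) u) not (suc (count k ks)) ≡⟨ cong (fold (letter (k ∸ 1) u) not) (count-∷-≡ k ks) ⟨
    fold (letter (k ∸ 1) u) not (count k (k ∷ ks)) ∎
  ... | on-ks , _ | no k≢j = begin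
    letter (j ∸ 1) (φ a k (applyList a ks u))    ≡⟨ letter-φ-< k _ (∸-monoˡ-< (≤∧≢⇒< j≤k (k≢j ∘ sym)) 1≤j) ⟩
    letter (j ∸ 1) (applyList a ks u)            ≡⟨ letter-applyList-count ks u 1≤j j≤ks on-ks ⟩
    fold (letter (j ∸ 1) u) not (count j ks)     ≡⟨ cong (fold (letter (j ∸ 1) u) not) (count-∷-≢ ks k≢j) ⟨
    fold (letter (j ∸ 1) u) not (count j (k ∷ ks)) ∎

lemma2p5 : (m : ℕ) → 1 ≤ m → (a : Vec Bool (suc m)) → (n : ℕ) → 1 ≤ n →
           (i : ℕ) → 1 ≤ i → i ≤ n →
           (j₀ : ℕ) (js : List ℕ) →
           All (i <_) (j₀ ∷ js) →
           ¬ (∀ (u : Word n) → φ a i (applyList a (j₀ ∷ js) u) ≡ applyList a (j₀ ∷ js) (φ a i u)) →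
           (∃ λ (x : Word n) → ActsCompletely a (i ∷ (j₀ ∷ js) ++ (i ∷ [])) x) →
           2 ∣ count (minList j₀ js) (j₀ ∷ js)
lemma2p5 m _ a n _ (suc i) _ _ j₀ js i<Υ noncommuting (x , complete)
  with ActsCompletely-sandwich a (suc i) (j₀ ∷ js) x complete
... | x-changed , on-Υ , z-changed = fold-not-fixed⇒even (count j Υ) (begin
    fold (letter (j ∸ 1) y) not (count j Υ)
      ≡⟨ letter-applyList-count a Υ y 1≤j j≤Υ on-Υ ⟨
    letter (j ∸ 1) z
      ≡⟨ window-≡⇒letter-≡ a z y same-window (s≤s z≤n) (<⇒≤ i<j) j≤i+m ⟩
    letter (j ∸ 1) y
      ∎)
  where
  Υ : List ℕ
  Υ = j₀ ∷ js
  j : ℕ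
  j = minList j₀ js
  y z : Word n
  y = φ a (suc i) x
  z = applyList a Υ y

  j≤Υ : All (j ≤_) Υ
  j≤Υ = minList-≤ j₀ js
  i<j : suc i < j
  i<j = All.lookup i<Υ (minList-∈ j₀ js)
  1≤j : 1 ≤ j
  1≤j = ≤-trans (s≤s z≤n) (<⇒≤ i<j)
  j≤i+m : j ≤ suc i + m
  j≤i+m = ¬comm⇒lowerBound≤ a (suc i) Υ (s≤s z≤n) noncommuting j≤Υ

  same-window : window a (suc i) z ≡ window a (suc i) y
  same-window = window-≡ a (suc i) (Matches-window-changed a (suc i) z z-changed)
    (Matches-window-φ-changed a (suc i) x x-changed)
    (letter-applyList-< a Υ y (All.map (λ i<k → ∸-monoˡ-< i<k (s≤s z≤n)) i<Υ))
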